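{- For every positive integer $n\notin O_{\mathrm{FS}}$, the group $\mathbb Z/n\mathbb Z$ is not $\mathrm{FS}$-regular.
   Context: Multisets: finite multisets counted with multiplicity; for a finite multiset $A=\{a_1,\dots,a_k\}$ in an abelian group $G$, $\mathrm{FS}(A)$ is the multiset of the $2^k$ sums $\sum_{i\in I}a_i$, $I\subseteq\{1,\dots,k\}$. $A\sim_0A'$ means there is a sub-multiset $B\subseteq A$ with $\sum_{b\in B}b=0$ and $A'=(A\setminus B)\cup(-B)$. $G$ is $\mathrm{FS}$-regular if for all finite multisets $A,A'$ in $G$: $\mathrm{FS}(A)=\mathrm{FS}(A')$ iff $A\sim_0A'$. $O_{\mathrm{FS}}$ is the set of odd integers $n\ge1$ such that for every $x\in\mathbb Z$ coprime to $n$ there exists $j\ge0$ with $n\mid x-2^j$ or $n\mid x+2^j$ (in particular every even $n$ is not in $O_{\mathrm{FS}}$). -}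

module Defs where

open import Data.Nat using (ℕ; zero; suc; _+_; _*_; _∸_; _^_; NonZero)
open import Data.Nat.DivMod using (_mod_)
open import Data.Nat.Coprimality using (Coprime)
open import Data.Fin using (Fin; toℕ)
open import Data.Integer as ℤ using (ℤ; +_; ∣_∣)
open import Data.Integer.Divisibility as ℤD using ()
open import Data.List using (List; []; _∷_; _++_; map; foldr)
open import Data.List.Relation.Binary.Permutation.Propositional using (_↭_)
open import Data.Product using (Σ; ∃; ∃-syntax; _×_; _,_)
open import Data.Sum using (_⊎_)
open import Relation.Binary.PropositionalEquality using (_≡_)

module ZMod (n : ℕ) .{{_ : NonZero n}} where

  Zn : Set
  Zn = Fin n

  0z : Zn
  0z = 0 mod n

  _⊕_ : Zn → Zn → Zn
  a ⊕ b = (toℕ a + toℕ b) mod n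

  ⊖_ : Zn → Zn
  ⊖ a = (n ∸ toℕ a) mod n

  -- Finite multisets are lists, considered up to permutation (_↭_).
  Σz : List Zn → Zn
  Σz = foldr _⊕_ 0z

  FS : List Zn → List Zn
  FS []       = 0z ∷ []
  FS (a ∷ as) = FS as ++ map (a ⊕_) (FS as)

  -- A ~₀ A' : there is a sub-multiset B of A with sum 0 and
  -- A' = (A \ B) ∪ (-B)   (C plays the role of A \ B).
  _~₀_ : List Zn → List Zn → Set
  A ~₀ A' = ∃[ B ] ∃[ C ] ((A ↭ B ++ C) × (Σz B ≡ 0z) × (A' ↭ map ⊖_ B ++ C))

  FSRegular : Set
  FSRegular = (A A' : List Zn) → ((FS A ↭ FS A') → A ~₀ A') × (A ~₀ A' → FS A ↭ FS A')

Odd : ℕ → Set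
Odd n = ∃[ k ] (n ≡ suc (2 * k))

InOFS : ℕ → Set
InOFS n = (1 Data.Nat.≤ n) × Odd n ×
  ((x : ℤ) → Coprime ∣ x ∣ n →
     ∃[ j ] ((+ n ℤD.∣ (x ℤ.- + (2 ^ j))) ⊎ (+ n ℤD.∣ (x ℤ.+ + (2 ^ j)))))

-- If n is even, e = n/2 has order two: {e, e} and {0, e} have the same subset sums,
-- yet 0 is not ± an element of {e, e}. If n > 1 is odd, 2 is a unit, of order K say,
-- and the subset sums of A = {1, 2, …, 2^(K−1)} are 0, 1, …, 2^K − 1 modulo n: every
-- residue equally often, plus one extra 0. Multiplication by a unit c permutes this
-- multiset and commutes with FS, so FS(cA) = FS(A); regularity gives A ~₀ cA, and
-- c = c·1 ∈ cA must be ±2^i modulo n, i.e. n ∈ O_FS.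
module Submission where

open import Defs
open import Data.Fin using (Fin; toℕ)
open import Data.Fin.Properties using (toℕ-fromℕ<; toℕ-injective; toℕ<n; pigeonhole)
open import Data.Integer as ℤ using (+_; -[1+_]; ∣_∣)
import Data.Integer.Divisibility as ℤD
import Data.Integer.Divisibility.Signed as ℤS
import Data.Integer.Tactic.RingSolver as ℤSolver
open import Data.List using (List; []; _∷_; _++_; [_]; map; applyUpTo; downFrom)
open import Data.List.Properties using (map-++; map-∘; map-cong; map-applyUpTo; applyUpTo-∷ʳ)
open import Data.List.Membership.Propositional using (_∈_)
open import Data.List.Membership.Propositional.Properties
  using (∈-map⁺; ∈-map⁻; ∈-++⁺ˡ; ∈-++⁺ʳ; ∈-++⁻; ∈-applyUpTo⁺; ∈-downFrom⁺)
open import Data.List.Membership.Propositional.Properties.WithK using (unique∧set⇒bag)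
open import Data.List.Relation.Binary.BagAndSetEquality using (∼bag⇒↭)
open import Data.List.Relation.Binary.Permutation.Propositional
  using (_↭_; ↭-refl; ↭-sym; ↭-reflexive; ↭-prep; ↭-swap; module PermutationReasoning)
open import Data.List.Relation.Binary.Permutation.Propositional.Properties using (++⁺; ∈-resp-↭)
open import Data.List.Relation.Unary.Any using (here; there)
open import Data.List.Relation.Unary.Unique.Propositional using (Unique)
import Data.List.Relation.Unary.Unique.Propositional.Properties as Unique
open import Data.Nat using (ℕ; zero; suc; _+_; _*_; _∸_; _^_; _<_; s≤s; z≤n; NonZero)
open import Data.Nat.Coprimality as Coprime using (Coprime; coprime-Bézout; coprime-+; 1-coprimeTo)
open import Data.Nat.DivMod
open import Data.Nat.Divisibility using (∣-refl; 1∣_; n∣m*n; ∣n⇒∣m*n; m%n≡0⇒n∣m)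
open import Data.Nat.GCD using (module Bézout)
open import Data.Nat.Properties
open import Data.Nat.Tactic.RingSolver using (solve)
open import Data.Product as Product using (∃-syntax; _×_; _,_; proj₁)
open import Data.Sum using (_⊎_; inj₁; inj₂; [_,_]′)
open import Function using (_∘_)
open import Function.Bundles using (mk⇔)
open import Relation.Binary.PropositionalEquality
  using (_≡_; _≢_; refl; sym; trans; cong; cong₂; subst; module ≡-Reasoning)
open import Relation.Nullary using (¬_)

module _ {a} {A : Set a} where

  applyUpTo-+ : ∀ (f : ℕ → A) L L′ →
                applyUpTo f (L + L′) ≡ applyUpTo f L ++ applyUpTo (λ j → f (L + j)) L′
  applyUpTo-+ f zero    L′ = refl
  applyUpTo-+ f (suc L) L′ = cong (f 0 ∷_) (applyUpTo-+ (f ∘ suc) L L′)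

  applyUpTo-cong : ∀ {f g : ℕ → A} → (∀ i → f i ≡ g i) → ∀ L → applyUpTo f L ≡ applyUpTo g L
  applyUpTo-cong f≗g zero    = refl
  applyUpTo-cong f≗g (suc L) = cong₂ _∷_ (f≗g 0) (applyUpTo-cong (f≗g ∘ suc) L)

  map-inverse-↭ : ∀ {f g : A → A} {xs} → (∀ x → g (f x) ≡ x) → (∀ x → f (g x) ≡ x) →
                  Unique xs → (∀ x → x ∈ xs) → map f xs ↭ xs
  map-inverse-↭ {f} {g} {xs} g∘f≗id f∘g≗id unique complete = ∼bag⇒↭ (unique∧set⇒bag
    (Unique.map⁺ (λ {x} {y} fx≡fy → trans (sym (g∘f≗id x)) (trans (cong g fx≡fy) (g∘f≗id y))) unique)
    unique
    (λ {x} → mk⇔ (λ _ → complete x) (λ _ → subst (_∈ map f xs) (f∘g≗id x) (∈-map⁺ f (complete (g x))))))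

[i+j]-[i+k]≡j-k : ∀ i j k → (i ℤ.+ j) ℤ.- (i ℤ.+ k) ≡ j ℤ.- k
[i+j]-[i+k]≡j-k = ℤSolver.solve-∀

neg-[i-j] : ∀ i j → ℤ.- (i ℤ.- j) ≡ ℤ.- i ℤ.+ j
neg-[i-j] = ℤSolver.solve-∀

neg-[i+j] : ∀ i j → ℤ.- (i ℤ.+ j) ≡ ℤ.- i ℤ.- j
neg-[i+j] = ℤSolver.solve-∀

module _ (n : ℕ) .{{_ : NonZero n}} where
  open ZMod n

  toℕ-mod : ∀ a → toℕ (a mod n) ≡ a % n
  toℕ-mod a = toℕ-fromℕ< _

  mod-toℕ : ∀ z → toℕ z mod n ≡ z
  mod-toℕ z = toℕ-injective (trans (toℕ-mod (toℕ z)) (m<n⇒m%n≡m (toℕ<n z)))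

  %-≡⇒mod-≡ : ∀ {a b} → a % n ≡ b % n → a mod n ≡ b mod n
  %-≡⇒mod-≡ {a} {b} eq = toℕ-injective (trans (toℕ-mod a) (trans eq (sym (toℕ-mod b))))

  mod-≡⇒%-≡ : ∀ {a b} → a mod n ≡ b mod n → a % n ≡ b % n
  mod-≡⇒%-≡ {a} {b} eq = trans (sym (toℕ-mod a)) (trans (cong toℕ eq) (toℕ-mod b))

  0%n≡0 : 0 % n ≡ 0
  0%n≡0 = m*n%n≡0 0 n

  n-mod-n : n mod n ≡ 0z
  n-mod-n = %-≡⇒mod-≡ (trans (n%n≡0 n) (sym 0%n≡0))

  mod-+ : ∀ a b → (a + b) mod n ≡ (a mod n) ⊕ (b mod n)
  mod-+ a b = %-≡⇒mod-≡ (begin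
    (a + b) % n                              ≡⟨ %-distribˡ-+ a b n ⟩
    (a % n + b % n) % n                      ≡⟨ cong₂ (λ u v → (u + v) % n) (toℕ-mod a) (toℕ-mod b) ⟨
    (toℕ (a mod n) + toℕ (b mod n)) % n      ∎)
    where open ≡-Reasoning

  ⊕-comm : ∀ a b → a ⊕ b ≡ b ⊕ a
  ⊕-comm a b = cong (_mod n) (+-comm (toℕ a) (toℕ b))

  ⊕-identityʳ : ∀ a → a ⊕ 0z ≡ a
  ⊕-identityʳ a = begin
    a ⊕ 0z                       ≡⟨ cong (_⊕ 0z) (mod-toℕ a) ⟨
    (toℕ a mod n) ⊕ (0 mod n)    ≡⟨ mod-+ (toℕ a) 0 ⟨
    (toℕ a + 0) mod n            ≡⟨ cong (_mod n) (+-identityʳ (toℕ a)) ⟩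
    toℕ a mod n                  ≡⟨ mod-toℕ a ⟩
    a                            ∎
    where open ≡-Reasoning

  ⊕-identityˡ : ∀ a → 0z ⊕ a ≡ a
  ⊕-identityˡ a = trans (⊕-comm 0z a) (⊕-identityʳ a)

  ⊕-inverseʳ : ∀ a → a ⊕ (⊖ a) ≡ 0z
  ⊕-inverseʳ a = begin
    a ⊕ (⊖ a)                                 ≡⟨ cong (_⊕ (⊖ a)) (mod-toℕ a) ⟨
    (toℕ a mod n) ⊕ ((n ∸ toℕ a) mod n)       ≡⟨ mod-+ (toℕ a) (n ∸ toℕ a) ⟨
    (toℕ a + (n ∸ toℕ a)) mod n               ≡⟨ cong (_mod n) (m+[n∸m]≡n (<⇒≤ (toℕ<n a))) ⟩
    n mod n                                   ≡⟨ n-mod-n ⟩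
    0z                                        ∎
    where open ≡-Reasoning

  ⊖≡0z⇒≡0z : ∀ {a} → ⊖ a ≡ 0z → a ≡ 0z
  ⊖≡0z⇒≡0z {a} ⊖a≡0z = begin
    a           ≡⟨ ⊕-identityʳ a ⟨
    a ⊕ 0z      ≡⟨ cong (a ⊕_) ⊖a≡0z ⟨
    a ⊕ (⊖ a)   ≡⟨ ⊕-inverseʳ a ⟩
    0z          ∎
    where open ≡-Reasoning

  -- Multiplication by natural numbers and units

  infixr 7 _⊙_

  _⊙_ : ℕ → Zn → Zn
  c ⊙ z = (c * toℕ z) mod n

  ⊙-mod : ∀ c a → c ⊙ (a mod n) ≡ (c * a) mod n
  ⊙-mod c a = %-≡⇒mod-≡ (begin
    (c * toℕ (a mod n)) % n      ≡⟨ cong (λ u → (c * u) % n) (toℕ-mod a) ⟩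
    (c * (a % n)) % n            ≡⟨ %-distribˡ-* c (a % n) n ⟩
    (c % n * (a % n % n)) % n    ≡⟨ cong (λ u → (c % n * u) % n) (m%n%n≡m%n a n) ⟩
    (c % n * (a % n)) % n        ≡⟨ %-distribˡ-* c a n ⟨
    (c * a) % n                  ∎)
    where open ≡-Reasoning

  ⊙-cong : ∀ {c d} → c mod n ≡ d mod n → ∀ z → c ⊙ z ≡ d ⊙ z
  ⊙-cong {c} {d} c≡d z = %-≡⇒mod-≡ (begin
    (c * toℕ z) % n                ≡⟨ %-distribˡ-* c (toℕ z) n ⟩
    (c % n * (toℕ z % n)) % n      ≡⟨ cong (λ u → (u * (toℕ z % n)) % n) (mod-≡⇒%-≡ c≡d) ⟩
    (d % n * (toℕ z % n)) % n      ≡⟨ %-distribˡ-* d (toℕ z) n ⟨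
    (d * toℕ z) % n                ∎)
    where open ≡-Reasoning

  ⊙-identityˡ : ∀ z → 1 ⊙ z ≡ z
  ⊙-identityˡ z = trans (cong (_mod n) (*-identityˡ (toℕ z))) (mod-toℕ z)

  *-⊙ : ∀ c d z → (c * d) ⊙ z ≡ c ⊙ d ⊙ z
  *-⊙ c d z = trans (cong (_mod n) (*-assoc c d (toℕ z))) (sym (⊙-mod c (d * toℕ z)))

  ⊙-0z : ∀ c → c ⊙ 0z ≡ 0z
  ⊙-0z c = trans (⊙-mod c 0) (cong (_mod n) (*-zeroʳ c))

  ⊙-⊕ : ∀ c a b → c ⊙ (a ⊕ b) ≡ (c ⊙ a) ⊕ (c ⊙ b)
  ⊙-⊕ c a b = begin
    c ⊙ ((toℕ a + toℕ b) mod n)          ≡⟨ ⊙-mod c (toℕ a + toℕ b) ⟩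
    (c * (toℕ a + toℕ b)) mod n          ≡⟨ cong (_mod n) (*-distribˡ-+ c (toℕ a) (toℕ b)) ⟩
    (c * toℕ a + c * toℕ b) mod n        ≡⟨ mod-+ (c * toℕ a) (c * toℕ b) ⟩
    (c ⊙ a) ⊕ (c ⊙ b)                    ∎
    where open ≡-Reasoning

  ⊙-inverse : ∀ {c d} → (d * c) mod n ≡ 1 mod n → ∀ z → d ⊙ c ⊙ z ≡ z
  ⊙-inverse {c} {d} dc≡1 z = trans (sym (*-⊙ d c z)) (trans (⊙-cong dc≡1 z) (⊙-identityˡ z))

  coprime⇒inverse : ∀ {c} → Coprime c n → ∃[ d ] (d * c) mod n ≡ 1 mod n
  coprime⇒inverse {c} cop with coprime-Bézout cop
  ... | Bézout.+- x y 1+yn≡xc = x , %-≡⇒mod-≡ (begin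
    (x * c) % n        ≡⟨ cong (_% n) 1+yn≡xc ⟨
    (1 + y * n) % n    ≡⟨ [m+kn]%n≡m%n 1 y n ⟩
    1 % n              ∎)
    where open ≡-Reasoning
  -- x c ≡ −1, so x c x inverts c: (x c)² + 2 y n = 1 + (y n)² when y n = 1 + x c.
  ... | Bézout.-+ x y 1+xc≡yn = x * c * x , %-≡⇒mod-≡ (begin
    (x * c * x * c) % n                    ≡⟨ cong (_% n) (*-assoc (x * c) x c) ⟩
    (x * c * (x * c)) % n                  ≡⟨ %-remove-+ʳ _ (∣n⇒∣m*n 2 (n∣m*n y)) ⟨
    (x * c * (x * c) + 2 * (y * n)) % n    ≡⟨ cong (λ b → (x * c * (x * c) + 2 * b) % n) 1+xc≡yn ⟨
    (x * c * (x * c) + 2 * (1 + x * c)) % n ≡⟨ cong (_% n) (solve (x ∷ c ∷ [])) ⟩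
    (1 + (1 + x * c) * (1 + x * c)) % n    ≡⟨ cong (λ b → (1 + b * b) % n) 1+xc≡yn ⟩
    (1 + y * n * (y * n)) % n              ≡⟨ %-remove-+ʳ 1 (∣n⇒∣m*n (y * n) (n∣m*n y)) ⟩
    1 % n                                  ∎)
    where open ≡-Reasoning

  ⊙-cancel : ∀ {c a b} → Coprime c n → c ⊙ a ≡ c ⊙ b → a ≡ b
  ⊙-cancel {c} {a} {b} cop ca≡cb with d , dc≡1 ← coprime⇒inverse cop = begin
    a            ≡⟨ ⊙-inverse {c} {d} dc≡1 a ⟨
    d ⊙ c ⊙ a    ≡⟨ cong (d ⊙_) ca≡cb ⟩
    d ⊙ c ⊙ b    ≡⟨ ⊙-inverse {c} {d} dc≡1 b ⟩
    b            ∎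
    where open ≡-Reasoning

  ^-⊙-cancel : ∀ {c a b} → Coprime c n → ∀ i → c ^ i ⊙ a ≡ c ^ i ⊙ b → a ≡ b
  ^-⊙-cancel {c} {a} {b} cop zero    eq = begin
    a        ≡⟨ ⊙-identityˡ a ⟨
    1 ⊙ a    ≡⟨ eq ⟩
    1 ⊙ b    ≡⟨ ⊙-identityˡ b ⟩
    b        ∎
    where open ≡-Reasoning
  ^-⊙-cancel {c} {a} {b} cop (suc i) eq = ^-⊙-cancel cop i (⊙-cancel cop (begin
    c ⊙ c ^ i ⊙ a    ≡⟨ *-⊙ c (c ^ i) a ⟨
    c ^ suc i ⊙ a    ≡⟨ eq ⟩
    c ^ suc i ⊙ b    ≡⟨ *-⊙ c (c ^ i) b ⟩
    c ⊙ c ^ i ⊙ b    ∎))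
    where open ≡-Reasoning

  unit-order : ∀ {c} → Coprime c n → ∃[ k ] (c ^ suc k) mod n ≡ 1 mod n
  unit-order {c} cop
    with i , j , i<j , cⁱ≡cʲ ← pigeonhole (n<1+n n) (λ (i : Fin (suc n)) → (c ^ toℕ i) mod n)
    = k , sym (^-⊙-cancel cop (toℕ i) (begin
      c ^ toℕ i ⊙ (1 mod n)                ≡⟨ ⊙-mod (c ^ toℕ i) 1 ⟩
      (c ^ toℕ i * 1) mod n                ≡⟨ cong (_mod n) (*-identityʳ (c ^ toℕ i)) ⟩
      (c ^ toℕ i) mod n                    ≡⟨ cⁱ≡cʲ ⟩
      (c ^ toℕ j) mod n                    ≡⟨ cong (λ e → (c ^ e) mod n) i+1+k≡j ⟨
      (c ^ (toℕ i + suc k)) mod n          ≡⟨ cong (_mod n) (^-distribˡ-+-* c (toℕ i) (suc k)) ⟩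
      (c ^ toℕ i * c ^ suc k) mod n        ≡⟨ ⊙-mod (c ^ toℕ i) (c ^ suc k) ⟨
      c ^ toℕ i ⊙ ((c ^ suc k) mod n)      ∎))
    where
      open ≡-Reasoning
      k : ℕ
      k = toℕ j ∸ suc (toℕ i)
      i+1+k≡j : toℕ i + suc k ≡ toℕ j
      i+1+k≡j = trans (+-suc (toℕ i) k) (m+[n∸m]≡n i<j)

  -- Residue lists and subset sums

  residues : ℕ → List Zn
  residues = applyUpTo (_mod n)

  residues-unique : Unique (residues n)
  residues-unique = Unique.applyUpTo⁺₁ (_mod n) n λ {i} {j} i<j j<n i≡j → <⇒≢ i<j (begin
    i        ≡⟨ m<n⇒m%n≡m (<-trans i<j j<n) ⟨
    i % n    ≡⟨ mod-≡⇒%-≡ i≡j ⟩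
    j % n    ≡⟨ m<n⇒m%n≡m j<n ⟩
    j        ∎)
    where open ≡-Reasoning

  ∈-residues : ∀ z → z ∈ residues n
  ∈-residues z = subst (_∈ residues n) (mod-toℕ z) (∈-applyUpTo⁺ (_mod n) (toℕ<n z))

  residues-+n : ∀ L → residues (n + L) ≡ residues n ++ residues L
  residues-+n L = trans (applyUpTo-+ (_mod n) n L)
    (cong (residues n ++_) (applyUpTo-cong (λ j → %-≡⇒mod-≡ (%-remove-+ˡ j ∣-refl)) L))

  module _ {f g : Zn → Zn} (g∘f≗id : ∀ z → g (f z) ≡ z) (f∘g≗id : ∀ z → f (g z) ≡ z) where
    open PermutationReasoning

    map-residues-*-↭ : ∀ q → map f (residues (q * n)) ↭ residues (q * n)
    map-residues-*-↭ zero    = ↭-refl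
    map-residues-*-↭ (suc q) = begin
      map f (residues (n + q * n))                      ≡⟨ cong (map f) (residues-+n (q * n)) ⟩
      map f (residues n ++ residues (q * n))            ≡⟨ map-++ f (residues n) (residues (q * n)) ⟩
      map f (residues n) ++ map f (residues (q * n))    ↭⟨ ++⁺ (map-inverse-↭ g∘f≗id f∘g≗id residues-unique ∈-residues)
                                                               (map-residues-*-↭ q) ⟩
      residues n ++ residues (q * n)                    ≡⟨ residues-+n (q * n) ⟨
      residues (n + q * n)                              ∎

    map-residues-1+*-↭ : f 0z ≡ 0z → ∀ q → map f (residues (suc (q * n))) ↭ residues (suc (q * n))
    map-residues-1+*-↭ f0≡0 q = begin
      map f (residues (suc (q * n)))                        ≡⟨ cong (map f) (applyUpTo-∷ʳ (_mod n) (q * n)) ⟨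
      map f (residues (q * n) ++ [ (q * n) mod n ])          ≡⟨ map-++ f (residues (q * n)) _ ⟩
      map f (residues (q * n)) ++ [ f ((q * n) mod n) ]      ↭⟨ ++⁺ (map-residues-*-↭ q) (↭-reflexive (cong [_] f[qn]≡qn)) ⟩
      residues (q * n) ++ [ (q * n) mod n ]                  ≡⟨ applyUpTo-∷ʳ (_mod n) (q * n) ⟩
      residues (suc (q * n))                                 ∎
      where
        qn≡0z : (q * n) mod n ≡ 0z
        qn≡0z = %-≡⇒mod-≡ (trans (m*n%n≡0 q n) (sym 0%n≡0))
        f[qn]≡qn : f ((q * n) mod n) ≡ (q * n) mod n
        f[qn]≡qn = trans (cong f qn≡0z) (trans f0≡0 (sym qn≡0z))

  FS-map : ∀ {f : Zn → Zn} → f 0z ≡ 0z → (∀ a b → f (a ⊕ b) ≡ f a ⊕ f b) →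
           ∀ xs → FS (map f xs) ≡ map f (FS xs)
  FS-map f0≡0 f-⊕ []       = cong [_] (sym f0≡0)
  FS-map {f} f0≡0 f-⊕ (a ∷ xs) = begin
    FS (map f xs) ++ map (f a ⊕_) (FS (map f xs))     ≡⟨ cong (λ ys → ys ++ map (f a ⊕_) ys) (FS-map f0≡0 f-⊕ xs) ⟩
    map f (FS xs) ++ map (f a ⊕_) (map f (FS xs))     ≡⟨ cong (map f (FS xs) ++_) (map-∘ (FS xs)) ⟨
    map f (FS xs) ++ map (λ b → f a ⊕ f b) (FS xs)    ≡⟨ cong (map f (FS xs) ++_) (map-cong (λ b → sym (f-⊕ a b)) (FS xs)) ⟩
    map f (FS xs) ++ map (λ b → f (a ⊕ b)) (FS xs)    ≡⟨ cong (map f (FS xs) ++_) (map-∘ (FS xs)) ⟩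
    map f (FS xs) ++ map f (map (a ⊕_) (FS xs))       ≡⟨ map-++ f (FS xs) _ ⟨
    map f (FS xs ++ map (a ⊕_) (FS xs))               ∎
    where open ≡-Reasoning

  powerOfTwo : ℕ → Zn
  powerOfTwo i = (2 ^ i) mod n

  powersOfTwo : ℕ → List Zn
  powersOfTwo k = map powerOfTwo (downFrom k)

  FS-powersOfTwo : ∀ k → FS (powersOfTwo k) ≡ residues (2 ^ k)
  FS-powersOfTwo zero    = refl
  FS-powersOfTwo (suc k) = begin
    FS (powersOfTwo k) ++ map (a ⊕_) (FS (powersOfTwo k))
      ≡⟨ cong (λ ys → ys ++ map (a ⊕_) ys) (FS-powersOfTwo k) ⟩
    residues K ++ map (a ⊕_) (residues K)
      ≡⟨ cong (residues K ++_) (map-applyUpTo (_mod n) (a ⊕_) K) ⟩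
    residues K ++ applyUpTo (λ j → a ⊕ (j mod n)) K
      ≡⟨ cong (residues K ++_) (applyUpTo-cong (λ j → sym (mod-+ K j)) K) ⟩
    residues K ++ applyUpTo (λ j → (K + j) mod n) K
      ≡⟨ applyUpTo-+ (_mod n) K K ⟨
    residues (K + K)
      ≡⟨ cong (λ m → residues (K + m)) (+-identityʳ K) ⟨
    residues (2 ^ suc k)
      ∎
    where
      open ≡-Reasoning
      K : ℕ
      K = 2 ^ k
      a : Zn
      a = K mod n

  FS-powersOfTwo≡residues : 1 < n → Coprime 2 n →
                            ∃[ k ] ∃[ q ] FS (powersOfTwo (suc k)) ≡ residues (suc (q * n))
  FS-powersOfTwo≡residues 1<n cop with k , 2ᴷ≡1 ← unit-order cop
    = k , 2 ^ suc k / n , trans (FS-powersOfTwo (suc k)) (cong residues (begin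
      2 ^ suc k                              ≡⟨ m≡m%n+[m/n]*n (2 ^ suc k) n ⟩
      2 ^ suc k % n + 2 ^ suc k / n * n      ≡⟨ cong (_+ 2 ^ suc k / n * n) (mod-≡⇒%-≡ 2ᴷ≡1) ⟩
      1 % n + 2 ^ suc k / n * n              ≡⟨ cong (_+ 2 ^ suc k / n * n) (m<n⇒m%n≡m 1<n) ⟩
      suc (2 ^ suc k / n * n)                ∎))
    where open ≡-Reasoning

  -- Consequences of FS-regularity

  ~₀⇒∈± : ∀ {A A′ z} → A ~₀ A′ → z ∈ A′ → ∃[ a ] a ∈ A × (z ≡ a ⊎ z ≡ ⊖ a)
  ~₀⇒∈± (B , C , A↭B++C , _ , A′↭-B++C) z∈A′ with ∈-++⁻ (map ⊖_ B) (∈-resp-↭ A′↭-B++C z∈A′)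
  ... | inj₁ z∈-B with b , b∈B , z≡⊖b ← ∈-map⁻ ⊖_ z∈-B =
    b , ∈-resp-↭ (↭-sym A↭B++C) (∈-++⁺ˡ b∈B) , inj₂ z≡⊖b
  ... | inj₂ z∈C = _ , ∈-resp-↭ (↭-sym A↭B++C) (∈-++⁺ʳ B z∈C) , inj₁ refl

  FS-pair : ∀ a b → FS (a ∷ b ∷ []) ≡ 0z ∷ b ∷ a ∷ a ⊕ b ∷ []
  FS-pair a b = cong₂ (λ u v → 0z ∷ u ∷ v ∷ a ⊕ u ∷ []) (⊕-identityʳ b) (⊕-identityʳ a)

  FS-[e,e]↭FS-[0,e] : ∀ {e} → e ⊕ e ≡ 0z → FS (e ∷ e ∷ []) ↭ FS (0z ∷ e ∷ [])
  FS-[e,e]↭FS-[0,e] {e} e⊕e≡0z = begin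
    FS (e ∷ e ∷ [])              ≡⟨ FS-pair e e ⟩
    0z ∷ e ∷ e ∷ e ⊕ e ∷ []      ≡⟨ cong (λ u → 0z ∷ e ∷ e ∷ u ∷ []) e⊕e≡0z ⟩
    0z ∷ e ∷ e ∷ 0z ∷ []         ↭⟨ ↭-prep 0z (↭-prep e (↭-swap e 0z ↭-refl)) ⟩
    0z ∷ e ∷ 0z ∷ e ∷ []         ≡⟨ cong (λ u → 0z ∷ e ∷ 0z ∷ u ∷ []) (⊕-identityˡ e) ⟨
    0z ∷ e ∷ 0z ∷ 0z ⊕ e ∷ []    ≡⟨ FS-pair 0z e ⟨
    FS (0z ∷ e ∷ [])             ∎
    where open PermutationReasoning

  FSRegular⇒no-involution : FSRegular → ∀ {e} → e ⊕ e ≡ 0z → e ≡ 0z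
  FSRegular⇒no-involution regular {e} e⊕e≡0z
    with a , a∈ee , 0z≡±a ← ~₀⇒∈± (proj₁ (regular (e ∷ e ∷ []) (0z ∷ e ∷ [])) (FS-[e,e]↭FS-[0,e] e⊕e≡0z)) (here refl)
    = [ sym , ⊖≡0z⇒≡0z ∘ sym ]′ (subst (λ a → 0z ≡ a ⊎ 0z ≡ ⊖ a) (∈-pair a∈ee) 0z≡±a)
    where
      ∈-pair : ∀ {a} → a ∈ e ∷ e ∷ [] → a ≡ e
      ∈-pair (here a≡e)         = a≡e
      ∈-pair (there (here a≡e)) = a≡e

  even⇒¬FSRegular : ∀ h → n ≡ suc h + suc h → ¬ FSRegular
  even⇒¬FSRegular h n≡h+h regular = h≢0z (FSRegular⇒no-involution regular h⊕h≡0z)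
    where
      open ≡-Reasoning
      h⊕h≡0z : (suc h mod n) ⊕ (suc h mod n) ≡ 0z
      h⊕h≡0z = begin
        (suc h mod n) ⊕ (suc h mod n)    ≡⟨ mod-+ (suc h) (suc h) ⟨
        (suc h + suc h) mod n            ≡⟨ cong (_mod n) n≡h+h ⟨
        n mod n                          ≡⟨ n-mod-n ⟩
        0z                               ∎
      h≢0z : suc h mod n ≢ 0z
      h≢0z h≡0z = 1+n≢0 (begin
        suc h        ≡⟨ m<n⇒m%n≡m (subst (suc h <_) (sym n≡h+h) (m<m+n (suc h) (s≤s z≤n))) ⟨
        suc h % n    ≡⟨ mod-≡⇒%-≡ h≡0z ⟩
        0 % n        ≡⟨ 0%n≡0 ⟩
        0            ∎)

  FSRegular⇒unit∈±A : FSRegular → ∀ {A q c} → FS A ≡ residues (suc (q * n)) → 1 mod n ∈ A →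
                      Coprime c n → ∃[ a ] a ∈ A × (c mod n ≡ a ⊎ c mod n ≡ ⊖ a)
  FSRegular⇒unit∈±A regular {A} {q} {c} FS-A≡ 1∈A cop with d , dc≡1 ← coprime⇒inverse cop
    = ~₀⇒∈± (proj₁ (regular A (map (c ⊙_) A)) FS-A↭FS-cA) c∈cA
    where
      cd≡1 : (c * d) mod n ≡ 1 mod n
      cd≡1 = trans (cong (_mod n) (*-comm c d)) dc≡1

      FS-A↭FS-cA : FS A ↭ FS (map (c ⊙_) A)
      FS-A↭FS-cA = begin
        FS A                                    ≡⟨ FS-A≡ ⟩
        residues (suc (q * n))                  ↭⟨ map-residues-1+*-↭ (⊙-inverse {c} {d} dc≡1) (⊙-inverse {d} {c} cd≡1)
                                                                       (⊙-0z c) q ⟨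
        map (c ⊙_) (residues (suc (q * n)))     ≡⟨ cong (map (c ⊙_)) FS-A≡ ⟨
        map (c ⊙_) (FS A)                       ≡⟨ FS-map (⊙-0z c) (⊙-⊕ c) A ⟨
        FS (map (c ⊙_) A)                       ∎
        where open PermutationReasoning

      c∈cA : c mod n ∈ map (c ⊙_) A
      c∈cA = subst (_∈ map (c ⊙_) A) (trans (⊙-mod c 1) (cong (_mod n) (*-identityʳ c))) (∈-map⁺ (c ⊙_) 1∈A)

  FSRegular⇒unit≡±2^ : FSRegular → 1 < n → Coprime 2 n → ∀ {c} → Coprime c n →
                       ∃[ i ] (c mod n ≡ (2 ^ i) mod n ⊎ c mod n ≡ ⊖ ((2 ^ i) mod n))
  FSRegular⇒unit≡±2^ regular 1<n cop2 {c} cop =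
    let k , q , FS≡residues = FS-powersOfTwo≡residues 1<n cop2
        1∈A = ∈-map⁺ powerOfTwo (∈-downFrom⁺ (s≤s z≤n))
        a , a∈A , c≡±a = FSRegular⇒unit∈±A regular {powersOfTwo (suc k)} {q} {c} FS≡residues 1∈A cop
        i , _ , a≡2ⁱ = ∈-map⁻ powerOfTwo {xs = downFrom (suc k)} a∈A
    in i , subst (λ a → c mod n ≡ a ⊎ c mod n ≡ ⊖ a) a≡2ⁱ c≡±a

  mod-≡⇒∣- : ∀ {a b} → a mod n ≡ b mod n → + n ℤS.∣ (+ a ℤ.- + b)
  mod-≡⇒∣- {a} {b} a≡b = subst (+ n ℤS.∣_) (sym a-b≡) (ℤS.∣m∣n⇒∣m-n (n∣[m/n]*n a) (n∣[m/n]*n b))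
    where
      open ≡-Reasoning
      n∣[m/n]*n : ∀ m → + n ℤS.∣ + (m / n * n)
      n∣[m/n]*n m = ℤS.∣ᵤ⇒∣ (n∣m*n (m / n))
      a-b≡ : + a ℤ.- + b ≡ + (a / n * n) ℤ.- + (b / n * n)
      a-b≡ = begin
        + a ℤ.- + b
          ≡⟨ cong₂ (λ u v → + u ℤ.- + v) (m≡m%n+[m/n]*n a n) (m≡m%n+[m/n]*n b n) ⟩
        + (a % n + a / n * n) ℤ.- + (b % n + b / n * n)
          ≡⟨ cong (λ r → + (a % n + a / n * n) ℤ.- + (r + b / n * n)) (mod-≡⇒%-≡ a≡b) ⟨
        + (a % n + a / n * n) ℤ.- + (a % n + b / n * n)
          ≡⟨ [i+j]-[i+k]≡j-k (+ (a % n)) (+ (a / n * n)) (+ (b / n * n)) ⟩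
        + (a / n * n) ℤ.- + (b / n * n)
          ∎

  mod-≡⊖⇒∣+ : ∀ {a b} → a mod n ≡ ⊖ (b mod n) → + n ℤS.∣ (+ a ℤ.+ + b)
  mod-≡⊖⇒∣+ {a} {b} a≡-b = ℤS.∣ᵤ⇒∣ (m%n≡0⇒n∣m (a + b) n (begin
    (a + b) % n     ≡⟨ mod-≡⇒%-≡ a+b≡0z ⟩
    0 % n           ≡⟨ 0%n≡0 ⟩
    0               ∎))
    where
      open ≡-Reasoning
      a+b≡0z : (a + b) mod n ≡ 0z
      a+b≡0z = begin
        (a + b) mod n                   ≡⟨ mod-+ a b ⟩
        (a mod n) ⊕ (b mod n)           ≡⟨ cong (_⊕ (b mod n)) a≡-b ⟩
        (⊖ (b mod n)) ⊕ (b mod n)       ≡⟨ ⊕-comm (⊖ (b mod n)) (b mod n) ⟩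
        (b mod n) ⊕ (⊖ (b mod n))       ≡⟨ ⊕-inverseʳ (b mod n) ⟩
        0z                              ∎

  ±-mod⇒∣± : ∀ x b → (∣ x ∣ mod n ≡ b mod n ⊎ ∣ x ∣ mod n ≡ ⊖ (b mod n)) →
             (+ n ℤD.∣ (x ℤ.- + b)) ⊎ (+ n ℤD.∣ (x ℤ.+ + b))
  ±-mod⇒∣± (+ a)    b (inj₁ a≡b)  = inj₁ (ℤS.∣⇒∣ᵤ (mod-≡⇒∣- a≡b))
  ±-mod⇒∣± (+ a)    b (inj₂ a≡-b) = inj₂ (ℤS.∣⇒∣ᵤ (mod-≡⊖⇒∣+ a≡-b))
  ±-mod⇒∣± -[1+ a ] b (inj₁ a≡b)  =
    inj₂ (ℤS.∣⇒∣ᵤ (subst (+ n ℤS.∣_) (neg-[i-j] (+ suc a) (+ b)) (ℤS.∣m⇒∣-m (mod-≡⇒∣- a≡b))))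
  ±-mod⇒∣± -[1+ a ] b (inj₂ a≡-b) =
    inj₁ (ℤS.∣⇒∣ᵤ (subst (+ n ℤS.∣_) (neg-[i+j] (+ suc a) (+ b)) (ℤS.∣m⇒∣-m (mod-≡⊖⇒∣+ a≡-b))))

even⊎odd : ∀ n → (∃[ h ] n ≡ h + h) ⊎ Odd n
even⊎odd zero = inj₁ (0 , refl)
even⊎odd (suc n) with even⊎odd n
... | inj₁ (h , refl) = inj₂ (h , cong (λ m → suc (h + m)) (sym (+-identityʳ h)))
... | inj₂ (t , refl) = inj₁ (suc t , solve (t ∷ []))

odd⇒coprime-2 : ∀ {n} → Odd n → Coprime 2 n
odd⇒coprime-2 (t , refl) = Coprime.sym (coprime-odd t)
  where
    coprime-odd : ∀ t → Coprime (suc (2 * t)) 2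
    coprime-odd zero    = 1-coprimeTo 2
    coprime-odd (suc t) = subst (λ m → Coprime m 2) (cong suc (sym (*-suc 2 t))) (coprime-+ (coprime-odd t))

inOFS-1 : InOFS 1
inOFS-1 = s≤s z≤n , (0 , refl) , λ x _ → 0 , inj₁ (1∣ _)

proposition4p1 : (m : ℕ) → ¬ InOFS (suc m) → ¬ ZMod.FSRegular (suc m)
proposition4p1 zero    ∉OFS _       = ∉OFS inOFS-1
proposition4p1 (suc m) ∉OFS regular with even⊎odd (suc (suc m))
... | inj₁ (suc h , n≡h+h) = even⇒¬FSRegular (suc (suc m)) h n≡h+h regular
... | inj₂ odd             = ∉OFS (s≤s z≤n , odd , λ x x⊥n →
  Product.map₂ (λ {i} → ±-mod⇒∣± n x (2 ^ i))
               (FSRegular⇒unit≡±2^ n regular (s≤s (s≤s z≤n)) (odd⇒coprime-2 odd) x⊥n))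
  where
    n : ℕ
    n = suc (suc m)
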